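{- Let $M$ be a connected matroid and $\ell$ a positive integer. Assume there is a sequence of matroids $M_0=M,M_1,\dots,M_\ell$ on the same ground set $E(M)$ such that for each $i\in[\ell]$ there is a matroid $M_i^+$ on ground set $E(M)\cup\{e_i\}$ with $M_{i-1}=M_i^+\setminus e_i$ and $M_i=M_i^+/e_i$, and $M_\ell$ is not connected. If $C\subseteq E(M)$ satisfies $\lambda_M(C)>0$ and $\lambda_{M_\ell}(C)=0$, then there is a sequence of matroids $M'_0=M/C, M'_1,\dots,M'_m$ with $m\le \ell-\lambda_M(C)$ such that for every $i\in[m]$ the matroid $M'_i$ is a c$^*$-transformation of $M'_{i-1}$, and $M'_m=M_\ell/C$.
   Context: $\lambda_N(X)=r_N(X)+r_N(E(N)-X)-r(N)$ is the connectivity function of a matroid $N$. A matroid is connected if any two of its elements lie in a common circuit. $M'$ is a c$^*$-transformation of $M$ if there are a matroid $M^+$ and $f\in E(M^+)$ with $M=M^+\setminus f$ and $M'=M^+/f$. -}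

module Defs where

open import Data.Nat using (ℕ; suc; _+_; _∸_; _≤_; _<_)
open import Data.Fin using (Fin; zero)
open import Data.Fin.Subset
  using (Subset; _∈_; _⊆_; _⊂_; _∩_; _∪_; _─_; ∣_∣; ⊥; inside; outside)
open import Data.Vec using (_∷_)
open import Data.Product using (Σ; _×_)
open import Relation.Binary.PropositionalEquality using (_≡_; _≢_)

-- Convention: the rank of an arbitrary X is the rank of X ∩ E
-- (so the rank function is determined by its values on subsets of E).
record Matroid (n : ℕ) : Set where
  field
    E        : Subset n
    r        : Subset n → ℕ
    r-ground : ∀ X → r X ≡ r (X ∩ E)
    r-bound  : ∀ X → X ⊆ E → r X ≤ ∣ X ∣
    r-mono   : ∀ X Y → X ⊆ Y → Y ⊆ E → r X ≤ r Y
    r-submod : ∀ X Y → X ⊆ E → Y ⊆ E → r (X ∪ Y) + r (X ∩ Y) ≤ r X + r Y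

open Matroid public

_∖E_ : ∀ {n} → Matroid n → Subset n → Subset n
M ∖E X = E M ─ X

conn : ∀ {n} → Matroid n → Subset n → ℕ
conn M X = r M X + r M (M ∖E X) ∸ r M (E M)

Independent : ∀ {n} → Matroid n → Subset n → Set
Independent M X = X ⊆ E M × r M X ≡ ∣ X ∣

Dependent : ∀ {n} → Matroid n → Subset n → Set
Dependent M X = X ⊆ E M × r M X < ∣ X ∣

Circuit : ∀ {n} → Matroid n → Subset n → Set
Circuit M C = Dependent M C × (∀ D → D ⊂ C → Independent M D)

Connected : ∀ {n} → Matroid n → Set
Connected {n} M = ∀ (x y : Fin n) → x ∈ E M → y ∈ E M → x ≢ y →
  Σ (Subset n) λ C → Circuit M C × x ∈ C × y ∈ C

IsContraction : ∀ {n} → Matroid n → Subset n → Matroid n → Set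
IsContraction M C N =
  (E N ≡ E M ─ C) × (∀ X → r N X ≡ r M (X ∪ C) ∸ r M C)

-- Single-element extensions: M⁺ lives on the universe Fin (suc n) and the
-- added element f is the fresh element zero; a subset of Fin (suc n) is
-- b ∷ X with b saying whether f belongs to it.

IsDeletionF : ∀ {n} → Matroid (suc n) → Matroid n → Set
IsDeletionF M⁺ M =
  (E M⁺ ≡ inside ∷ E M) × (∀ X → r M X ≡ r M⁺ (outside ∷ X))

IsContractionF : ∀ {n} → Matroid (suc n) → Matroid n → Set
IsContractionF M⁺ M' =
  (E M⁺ ≡ inside ∷ E M') × (∀ X → r M' X ≡ r M⁺ (inside ∷ X) ∸ r M⁺ (inside ∷ ⊥))

CStar : ∀ {n} → Matroid n → Matroid n → Set
CStar {n} M M' = Σ (Matroid (suc n)) λ M⁺ → IsDeletionF M⁺ M × IsContractionF M⁺ M'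

{-# OPTIONS --safe #-}
-- Let M⁺ realise one c*-step A = M⁺ ∖ f, B = M⁺ / f, and let C ⊆ E. Submodularity of
-- the rank of M⁺ gives λ_A(C) + r(C ∪ f) ≤ λ_B(C) + r(C) + r(f), where r(f) ≤ 1.
-- If C spans f, then f is a loop of M⁺ / C, so A / C = B / C, and λ drops by at most one.
-- Otherwise M⁺ / C exhibits B / C as a c*-transformation of A / C, and λ does not drop.
-- So each genuine c*-step between the contractions costs a step of the original sequence
-- at which λ does not drop; as λ falls from λ_M(C) to 0 in ℓ steps, there are at most
-- ℓ − λ_M(C) of them.
module Submission where

open import Defs
open import Data.Nat using (ℕ; zero; suc; _+_; _∸_; _≤_; _<_; s≤s; s≤s⁻¹; z<s)
open import Data.Nat.Properties
open import Data.Nat.Tactic.RingSolver using (solve-∀)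
open import Data.Fin.Subset using (Subset; _⊆_; _∩_; _∪_; _─_; ∣_∣; ⊥; inside; outside)
open import Data.Fin.Subset.Properties
  using (x∈p∩q⁺; x∈p∩q⁻; x∈p∪q⁺; x∈p∪q⁻; p∩q⊆q; p─q⊆p; p⊆p∪q; q⊆p∪q; ∣p∩q∣≤∣p∣; ∣⊥∣≡0;
         drop-∷-⊆; out⊆; s⊆s; ⊆-refl; ⊆-min; ∪-identityˡ; ∩-distribʳ-∪; ∪-distribʳ-∩;
         ∩-idempotentCommutativeMonoid; ∪-idempotentCommutativeMonoid)
open import Data.Vec using ([]; _∷_; here)
open import Data.Vec.Properties using (∷-injectiveʳ)
open import Data.Product using (Σ; _×_; _,_; proj₁; proj₂; map₁)
open import Data.Sum using (_⊎_; inj₁; inj₂)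
import Data.Sum as Sum
open import Function using (_∘_)
open import Relation.Nullary using (¬_)
open import Relation.Binary.PropositionalEquality
  using (_≡_; refl; sym; trans; cong; cong₂; subst; module ≡-Reasoning)
import Algebra.Properties.IdempotentCommutativeMonoid as IdempotentCommutativeMonoidProperties

∩-distribʳ-∩ : ∀ {n} (r p q : Subset n) → (p ∩ q) ∩ r ≡ (p ∩ r) ∩ (q ∩ r)
∩-distribʳ-∩ {n} = IdempotentCommutativeMonoidProperties.∙-distrʳ-∙ (∩-idempotentCommutativeMonoid n)

∪-distribʳ-∪ : ∀ {n} (r p q : Subset n) → (p ∪ q) ∪ r ≡ (p ∪ r) ∪ (q ∪ r)
∪-distribʳ-∪ {n} = IdempotentCommutativeMonoidProperties.∙-distrʳ-∙ (∪-idempotentCommutativeMonoid n)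

∩-monoˡ-⊆ : ∀ {n} {p q : Subset n} r → p ⊆ q → p ∩ r ⊆ q ∩ r
∩-monoˡ-⊆ {p = p} r p⊆q = x∈p∩q⁺ ∘ map₁ p⊆q ∘ x∈p∩q⁻ p r

∪-monoˡ-⊆ : ∀ {n} {p q : Subset n} r → p ⊆ q → p ∪ r ⊆ q ∪ r
∪-monoˡ-⊆ {p = p} r p⊆q = x∈p∪q⁺ ∘ Sum.map₁ p⊆q ∘ x∈p∪q⁻ p r

p∪[q─p]≡q : ∀ {n} {p q : Subset n} → p ⊆ q → p ∪ (q ─ p) ≡ q
p∪[q─p]≡q {p = []}          {[]}          _   = refl
p∪[q─p]≡q {p = inside  ∷ p} {inside  ∷ q} p⊆q = cong (inside ∷_) (p∪[q─p]≡q (drop-∷-⊆ p⊆q))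
p∪[q─p]≡q {p = inside  ∷ p} {outside ∷ q} p⊆q with p⊆q here
... | ()
p∪[q─p]≡q {p = outside ∷ p} {x       ∷ q} p⊆q = cong (x ∷_) (p∪[q─p]≡q (drop-∷-⊆ p⊆q))

[p∪q]∩r≡[p∩[r─q]∪q]∩r : ∀ {n} (p q r : Subset n) → (p ∪ q) ∩ r ≡ ((p ∩ (r ─ q)) ∪ q) ∩ r
[p∪q]∩r≡[p∩[r─q]∪q]∩r []            []            []            = refl
[p∪q]∩r≡[p∩[r─q]∪q]∩r (inside  ∷ p) (inside  ∷ q) (x       ∷ r) =
  cong (x ∷_) ([p∪q]∩r≡[p∩[r─q]∪q]∩r p q r)
[p∪q]∩r≡[p∩[r─q]∪q]∩r (outside ∷ p) (inside  ∷ q) (x       ∷ r) =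
  cong (x ∷_) ([p∪q]∩r≡[p∩[r─q]∪q]∩r p q r)
[p∪q]∩r≡[p∩[r─q]∪q]∩r (inside  ∷ p) (outside ∷ q) (inside  ∷ r) =
  cong (inside ∷_) ([p∪q]∩r≡[p∩[r─q]∪q]∩r p q r)
[p∪q]∩r≡[p∩[r─q]∪q]∩r (inside  ∷ p) (outside ∷ q) (outside ∷ r) =
  cong (outside ∷_) ([p∪q]∩r≡[p∩[r─q]∪q]∩r p q r)
[p∪q]∩r≡[p∩[r─q]∪q]∩r (outside ∷ p) (outside ∷ q) (x       ∷ r) =
  cong (outside ∷_) ([p∪q]∩r≡[p∩[r─q]∪q]∩r p q r)

[m∸o]∸[n∸o]≡m∸n : ∀ m {n o} → o ≤ n → (m ∸ o) ∸ (n ∸ o) ≡ m ∸ n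
[m∸o]∸[n∸o]≡m∸n m {n} {o} o≤n = trans (∸-+-assoc m o (n ∸ o)) (cong (m ∸_) (m+[n∸m]≡n o≤n))

[m∸o]+[n∸o]≡[m+n]∸[o+o] : ∀ {m n o} → o ≤ m → o ≤ n → (m ∸ o) + (n ∸ o) ≡ (m + n) ∸ (o + o)
[m∸o]+[n∸o]≡[m+n]∸[o+o] {m} {n} {o} o≤m o≤n = begin
  (m ∸ o) + (n ∸ o)  ≡⟨ +-∸-comm (n ∸ o) o≤m ⟨
  (m + (n ∸ o)) ∸ o  ≡⟨ cong (_∸ o) (+-∸-assoc m o≤n) ⟨
  (m + n ∸ o) ∸ o    ≡⟨ ∸-+-assoc (m + n) o o ⟩
  (m + n) ∸ (o + o)  ∎
  where open ≡-Reasoning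

module _ {n : ℕ} (M : Matroid n) where

  r-cong-∩E : ∀ {X Y} → X ∩ E M ≡ Y ∩ E M → r M X ≡ r M Y
  r-cong-∩E {X} {Y} eq = trans (r-ground M X) (trans (cong (r M) eq) (sym (r-ground M Y)))

  r-bound′ : ∀ X → r M X ≤ ∣ X ∣
  r-bound′ X = begin
    r M X          ≡⟨ r-ground M X ⟩
    r M (X ∩ E M)  ≤⟨ r-bound M (X ∩ E M) (p∩q⊆q X (E M)) ⟩
    ∣ X ∩ E M ∣    ≤⟨ ∣p∩q∣≤∣p∣ X (E M) ⟩
    ∣ X ∣          ∎
    where open ≤-Reasoning

  r-mono′ : ∀ {X Y} → X ⊆ Y → r M X ≤ r M Y
  r-mono′ {X} {Y} X⊆Y = begin
    r M X          ≡⟨ r-ground M X ⟩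
    r M (X ∩ E M)  ≤⟨ r-mono M _ _ (∩-monoˡ-⊆ (E M) X⊆Y) (p∩q⊆q Y (E M)) ⟩
    r M (Y ∩ E M)  ≡⟨ r-ground M Y ⟨
    r M Y          ∎
    where open ≤-Reasoning

  r-submod′ : ∀ X Y → r M (X ∪ Y) + r M (X ∩ Y) ≤ r M X + r M Y
  r-submod′ X Y = begin
    r M (X ∪ Y) + r M (X ∩ Y)
      ≡⟨ cong₂ _+_ (r-ground M (X ∪ Y)) (r-ground M (X ∩ Y)) ⟩
    r M ((X ∪ Y) ∩ E M) + r M ((X ∩ Y) ∩ E M)
      ≡⟨ cong₂ _+_ (cong (r M) (∩-distribʳ-∪ (E M) X Y)) (cong (r M) (∩-distribʳ-∩ (E M) X Y)) ⟩
    r M ((X ∩ E M) ∪ (Y ∩ E M)) + r M ((X ∩ E M) ∩ (Y ∩ E M))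
      ≤⟨ r-submod M (X ∩ E M) (Y ∩ E M) (p∩q⊆q X (E M)) (p∩q⊆q Y (E M)) ⟩
    r M (X ∩ E M) + r M (Y ∩ E M)
      ≡⟨ cong₂ _+_ (r-ground M X) (r-ground M Y) ⟨
    r M X + r M Y
      ∎
    where open ≤-Reasoning

  r-subadditive : ∀ X Y → r M (X ∪ Y) ≤ r M X + r M Y
  r-subadditive X Y = ≤-trans (m≤m+n (r M (X ∪ Y)) (r M (X ∩ Y))) (r-submod′ X Y)

  r-submod-∪ : ∀ C X Y → r M ((X ∪ Y) ∪ C) + r M ((X ∩ Y) ∪ C) ≤ r M (X ∪ C) + r M (Y ∪ C)
  r-submod-∪ C X Y = subst (_≤ r M (X ∪ C) + r M (Y ∪ C))
    (cong₂ _+_ (cong (r M) (sym (∪-distribʳ-∪ C X Y))) (cong (r M) (sym (∪-distribʳ-∩ C X Y))))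
    (r-submod′ (X ∪ C) (Y ∪ C))

  conn[X]+r[E]≡r[X]+r[E─X] : ∀ {X} → X ⊆ E M → conn M X + r M (E M) ≡ r M X + r M (M ∖E X)
  conn[X]+r[E]≡r[X]+r[E─X] {X} X⊆E = m∸n+n≡m (begin
    r M (E M)                ≡⟨ cong (r M) (p∪[q─p]≡q X⊆E) ⟨
    r M (X ∪ (M ∖E X))       ≤⟨ r-subadditive X (M ∖E X) ⟩
    r M X + r M (M ∖E X)     ∎)
    where open ≤-Reasoning

_／_ : ∀ {n} → Matroid n → Subset n → Matroid n
M ／ C = record
  { E        = E M ─ C
  ; r        = λ X → r M (X ∪ C) ∸ r M C
  ; r-ground = λ X → cong (_∸ r M C) (r-cong-∩E M ([p∪q]∩r≡[p∩[r─q]∪q]∩r X C (E M)))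
  ; r-bound  = λ X _ → m≤n+o⇒m∸n≤o (r M (X ∪ C)) (r M C) (bound X)
  ; r-mono   = λ X Y X⊆Y _ → ∸-monoˡ-≤ (r M C) (r-mono′ M (∪-monoˡ-⊆ C X⊆Y))
  ; r-submod = λ X Y _ _ → submod X Y
  }
  where
  r[C]≤ : ∀ X → r M C ≤ r M (X ∪ C)
  r[C]≤ X = r-mono′ M (q⊆p∪q X C)

  bound : ∀ X → r M (X ∪ C) ≤ r M C + ∣ X ∣
  bound X = begin
    r M (X ∪ C)      ≤⟨ r-subadditive M X C ⟩
    r M X + r M C    ≤⟨ +-monoˡ-≤ (r M C) (r-bound′ M X) ⟩
    ∣ X ∣ + r M C    ≡⟨ +-comm ∣ X ∣ (r M C) ⟩
    r M C + ∣ X ∣    ∎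
    where open ≤-Reasoning

  submod : ∀ X Y → (r M ((X ∪ Y) ∪ C) ∸ r M C) + (r M ((X ∩ Y) ∪ C) ∸ r M C)
                   ≤ (r M (X ∪ C) ∸ r M C) + (r M (Y ∪ C) ∸ r M C)
  submod X Y = begin
    (r M ((X ∪ Y) ∪ C) ∸ r M C) + (r M ((X ∩ Y) ∪ C) ∸ r M C)
      ≡⟨ [m∸o]+[n∸o]≡[m+n]∸[o+o] (r[C]≤ (X ∪ Y)) (r[C]≤ (X ∩ Y)) ⟩
    (r M ((X ∪ Y) ∪ C) + r M ((X ∩ Y) ∪ C)) ∸ (r M C + r M C)
      ≤⟨ ∸-monoˡ-≤ (r M C + r M C) (r-submod-∪ M C X Y) ⟩
    (r M (X ∪ C) + r M (Y ∪ C)) ∸ (r M C + r M C)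
      ≡⟨ [m∸o]+[n∸o]≡[m+n]∸[o+o] (r[C]≤ X) (r[C]≤ Y) ⟨
    (r M (X ∪ C) ∸ r M C) + (r M (Y ∪ C) ∸ r M C)
      ∎
    where open ≤-Reasoning

／-isContraction : ∀ {n} (M : Matroid n) (C : Subset n) → IsContraction M C (M ／ C)
／-isContraction M C = refl , λ _ → refl

module SingleElementExtension {n : ℕ} (P : Matroid (suc n)) where

  r₀ r₁ : Subset n → ℕ
  r₀ X = r P (outside ∷ X)
  r₁ X = r P (inside ∷ X)

  Spans : Subset n → Set
  Spans X = r₁ X ≡ r₀ X

  r₀≤r₁ : ∀ X → r₀ X ≤ r₁ X
  r₀≤r₁ X = r-mono′ P (out⊆ ⊆-refl)

  r₁[⊥]≤r₁ : ∀ X → r₁ ⊥ ≤ r₁ X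
  r₁[⊥]≤r₁ X = r-mono′ P (s⊆s (⊆-min X))

  r₁[⊥]≤1 : r₁ ⊥ ≤ 1
  r₁[⊥]≤1 = subst (r₁ ⊥ ≤_) (cong suc (∣⊥∣≡0 n)) (r-bound′ P (inside ∷ ⊥))

  marginal-antitone : ∀ {X Y} → X ⊆ Y → r₁ Y + r₀ X ≤ r₀ Y + r₁ X
  marginal-antitone {X} {Y} X⊆Y = begin
    r₁ Y + r₀ X                                      ≤⟨ +-mono-≤ Y≤Y∪X X≤Y∩X ⟩
    r P (inside ∷ (Y ∪ X)) + r P (outside ∷ (Y ∩ X))  ≤⟨ r-submod′ P (outside ∷ Y) (inside ∷ X) ⟩
    r₀ Y + r₁ X                                      ∎
    where
    open ≤-Reasoning
    Y≤Y∪X : r₁ Y ≤ r P (inside ∷ (Y ∪ X))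
    Y≤Y∪X = r-mono′ P (s⊆s (p⊆p∪q X))
    X≤Y∩X : r₀ X ≤ r P (outside ∷ (Y ∩ X))
    X≤Y∩X = r-mono′ P (out⊆ (λ x∈X → x∈p∩q⁺ (X⊆Y x∈X , x∈X)))

  r₁≤1+r₀ : ∀ X → r₁ X ≤ suc (r₀ X)
  r₁≤1+r₀ X = begin
    r₁ X                ≤⟨ m≤m+n (r₁ X) (r₀ ⊥) ⟩
    r₁ X + r₀ ⊥         ≤⟨ marginal-antitone (⊆-min X) ⟩
    r₀ X + r₁ ⊥         ≤⟨ +-monoʳ-≤ (r₀ X) r₁[⊥]≤1 ⟩
    r₀ X + 1            ≡⟨ +-comm (r₀ X) 1 ⟩
    suc (r₀ X)          ∎
    where open ≤-Reasoning

  spans⊎r₁≡1+r₀ : ∀ X → Spans X ⊎ r₁ X ≡ suc (r₀ X)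
  spans⊎r₁≡1+r₀ X with m≤n⇒m<n∨m≡n (r₀≤r₁ X)
  ... | inj₁ r₀<r₁ = inj₂ (≤-antisym (r₁≤1+r₀ X) r₀<r₁)
  ... | inj₂ r₀≡r₁ = inj₁ (sym r₀≡r₁)

  spans-upward : ∀ {X Y} → X ⊆ Y → Spans X → Spans Y
  spans-upward {X} {Y} X⊆Y X-spans = ≤-antisym r₁≤r₀ (r₀≤r₁ Y)
    where
    r₁≤r₀ : r₁ Y ≤ r₀ Y
    r₁≤r₀ = +-cancelʳ-≤ (r₀ X) (r₁ Y) (r₀ Y)
      (subst (λ k → r₁ Y + r₀ X ≤ r₀ Y + k) X-spans (marginal-antitone X⊆Y))

-- This is λ_A(C) + r(C ∪ f) ≤ λ_B(C) + r(C) + r(f), with each λ written without truncated subtraction.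
connectivity-arithmetic : ∀ {kA kB c₀ c₁ d₀ d₁ e₀ e₁ ρ} →
  kA + e₀ ≡ c₀ + d₀ → kB + e₁ + ρ ≡ c₁ + d₁ → e₁ + d₀ ≤ e₀ + d₁ → kA + c₁ ≤ kB + c₀ + ρ
connectivity-arithmetic {kA} {kB} {c₀} {c₁} {d₀} {d₁} {e₀} {e₁} {ρ} A-eq B-eq antitone =
  +-cancelʳ-≤ (e₀ + d₁) (kA + c₁) (kB + c₀ + ρ) (begin
    kA + c₁ + (e₀ + d₁)        ≡⟨ shuffle₁ kA c₁ e₀ d₁ ⟩
    (kA + e₀) + (c₁ + d₁)      ≡⟨ cong₂ _+_ A-eq (sym B-eq) ⟩
    (c₀ + d₀) + (kB + e₁ + ρ)  ≡⟨ shuffle₂ c₀ d₀ kB e₁ ρ ⟩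
    kB + c₀ + ρ + (e₁ + d₀)    ≤⟨ +-monoʳ-≤ (kB + c₀ + ρ) antitone ⟩
    kB + c₀ + ρ + (e₀ + d₁)    ∎)
  where
  open ≤-Reasoning
  shuffle₁ : ∀ a b c d → a + b + (c + d) ≡ (a + c) + (b + d)
  shuffle₁ = solve-∀
  shuffle₂ : ∀ c d k e p → (c + d) + (k + e + p) ≡ k + c + p + (e + d)
  shuffle₂ = solve-∀

module CStarStep {n : ℕ} (P : Matroid (suc n)) (A B : Matroid n)
                 (del : IsDeletionF P A) (con : IsContractionF P B) where
  open SingleElementExtension P

  E-B≡E-A : E B ≡ E A
  E-B≡E-A = ∷-injectiveʳ (trans (sym (proj₁ con)) (proj₁ del))

  r-A : ∀ X → r A X ≡ r₀ X
  r-A = proj₂ del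

  r-B+r₁[⊥] : ∀ X → r B X + r₁ ⊥ ≡ r₁ X
  r-B+r₁[⊥] X = trans (cong (_+ r₁ ⊥) (proj₂ con X)) (m∸n+n≡m (r₁[⊥]≤r₁ X))

  module _ {C : Subset n} (C⊆E : C ⊆ E A) where

    conn-A : conn A C + r₀ (E A) ≡ r₀ C + r₀ (E A ─ C)
    conn-A = begin
      conn A C + r₀ (E A)    ≡⟨ cong (conn A C +_) (r-A (E A)) ⟨
      conn A C + r A (E A)   ≡⟨ conn[X]+r[E]≡r[X]+r[E─X] A C⊆E ⟩
      r A C + r A (E A ─ C)  ≡⟨ cong₂ _+_ (r-A C) (r-A (E A ─ C)) ⟩
      r₀ C + r₀ (E A ─ C)    ∎
      where open ≡-Reasoning

    conn-B : conn B C + r₁ (E A) + r₁ ⊥ ≡ r₁ C + r₁ (E A ─ C)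
    conn-B = begin
      conn B C + r₁ (E A) + ρ               ≡⟨ cong (λ k → conn B C + k + ρ) (r-B+r₁[⊥] (E A)) ⟨
      conn B C + (r B (E A) + ρ) + ρ        ≡⟨ shuffle₁ (conn B C) (r B (E A)) ρ ⟩
      (conn B C + r B (E A)) + (ρ + ρ)      ≡⟨ cong (_+ (ρ + ρ)) conn-B-over-E-A ⟩
      (r B C + r B (E A ─ C)) + (ρ + ρ)     ≡⟨ shuffle₂ (r B C) (r B (E A ─ C)) ρ ⟩
      (r B C + ρ) + (r B (E A ─ C) + ρ)     ≡⟨ cong₂ _+_ (r-B+r₁[⊥] C) (r-B+r₁[⊥] (E A ─ C)) ⟩
      r₁ C + r₁ (E A ─ C)                   ∎
      where
      open ≡-Reasoning
      ρ = r₁ ⊥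
      conn-B-over-E-A : conn B C + r B (E A) ≡ r B C + r B (E A ─ C)
      conn-B-over-E-A = subst (λ Z → conn B C + r B Z ≡ r B C + r B (Z ─ C)) E-B≡E-A
        (conn[X]+r[E]≡r[X]+r[E─X] B (subst (C ⊆_) (sym E-B≡E-A) C⊆E))
      shuffle₁ : ∀ k e p → k + (e + p) + p ≡ (k + e) + (p + p)
      shuffle₁ = solve-∀
      shuffle₂ : ∀ x y p → (x + y) + (p + p) ≡ (x + p) + (y + p)
      shuffle₂ = solve-∀

    conn-bound : conn A C + r₁ C ≤ suc (conn B C + r₀ C)
    conn-bound = begin
      conn A C + r₁ C            ≤⟨ connectivity-arithmetic {kA = conn A C} {kB = conn B C} conn-A conn-B
                                      (marginal-antitone (p─q⊆p (E A) C)) ⟩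
      conn B C + r₀ C + r₁ ⊥     ≤⟨ +-monoʳ-≤ (conn B C + r₀ C) r₁[⊥]≤1 ⟩
      conn B C + r₀ C + 1        ≡⟨ +-comm (conn B C + r₀ C) 1 ⟩
      suc (conn B C + r₀ C)      ∎
      where open ≤-Reasoning

    spanned-contractions-agree : Spans C → ∀ N → IsContraction B C N → IsContraction A C N
    spanned-contractions-agree C-spans N (E-N , r-N) =
      trans E-N (cong (_─ C) E-B≡E-A) , λ X → trans (r-N X) (sym (rank-agrees X))
      where
      rank-agrees : ∀ X → r A (X ∪ C) ∸ r A C ≡ r B (X ∪ C) ∸ r B C
      rank-agrees X = begin
        r A (X ∪ C) ∸ r A C                         ≡⟨ cong₂ _∸_ (r-A (X ∪ C)) (r-A C) ⟩
        r₀ (X ∪ C) ∸ r₀ C                           ≡⟨ cong₂ _∸_ (spans-upward (q⊆p∪q X C) C-spans) C-spans ⟨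
        r₁ (X ∪ C) ∸ r₁ C                           ≡⟨ [m∸o]∸[n∸o]≡m∸n (r₁ (X ∪ C)) (r₁[⊥]≤r₁ C) ⟨
        (r₁ (X ∪ C) ∸ r₁ ⊥) ∸ (r₁ C ∸ r₁ ⊥)         ≡⟨ cong₂ _∸_ (proj₂ con (X ∪ C)) (proj₂ con C) ⟨
        r B (X ∪ C) ∸ r B C                         ∎
        where open ≡-Reasoning

    contractions-cstar : ∀ N N′ → IsContraction A C N → IsContraction B C N′ → CStar N N′
    contractions-cstar N N′ (E-N , r-N) (E-N′ , r-N′) =
      Q , (E-Q≡E-N , r-N≡r-Q∖f) , (E-Q≡E-N′ , r-N′≡r-Q／f)
      where
      Q = P ／ (outside ∷ C)

      E-Q : E Q ≡ inside ∷ (E A ─ C)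
      E-Q = cong (_─ (outside ∷ C)) (proj₁ del)

      E-Q≡E-N : E Q ≡ inside ∷ E N
      E-Q≡E-N = trans E-Q (cong (inside ∷_) (sym E-N))

      E-Q≡E-N′ : E Q ≡ inside ∷ E N′
      E-Q≡E-N′ = trans E-Q (cong (inside ∷_) (sym (trans E-N′ (cong (_─ C) E-B≡E-A))))

      r-N≡r-Q∖f : ∀ X → r N X ≡ r Q (outside ∷ X)
      r-N≡r-Q∖f X = trans (r-N X) (cong₂ _∸_ (r-A (X ∪ C)) (r-A C))

      r-N′≡r-Q／f : ∀ X → r N′ X ≡ r Q (inside ∷ X) ∸ r Q (inside ∷ ⊥)
      r-N′≡r-Q／f X = begin
        r N′ X                                   ≡⟨ r-N′ X ⟩
        r B (X ∪ C) ∸ r B C                      ≡⟨ cong₂ _∸_ (proj₂ con (X ∪ C)) (proj₂ con C) ⟩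
        (r₁ (X ∪ C) ∸ r₁ ⊥) ∸ (r₁ C ∸ r₁ ⊥)      ≡⟨ [m∸o]∸[n∸o]≡m∸n (r₁ (X ∪ C)) (r₁[⊥]≤r₁ C) ⟩
        r₁ (X ∪ C) ∸ r₁ C                        ≡⟨ [m∸o]∸[n∸o]≡m∸n (r₁ (X ∪ C)) (r₀≤r₁ C) ⟨
        (r₁ (X ∪ C) ∸ r₀ C) ∸ (r₁ C ∸ r₀ C)      ≡⟨ cong (λ Z → (r₁ (X ∪ C) ∸ r₀ C) ∸ (r₁ Z ∸ r₀ C))
                                                         (∪-identityˡ C) ⟨
        r Q (inside ∷ X) ∸ r Q (inside ∷ ⊥)      ∎
        where open ≡-Reasoning

    spanned-conn : Spans C → conn A C ≤ suc (conn B C)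
    spanned-conn C-spans = +-cancelʳ-≤ (r₀ C) (conn A C) (suc (conn B C))
      (subst (λ k → conn A C + k ≤ suc (conn B C + r₀ C)) C-spans conn-bound)

    unspanned-conn : r₁ C ≡ suc (r₀ C) → conn A C ≤ conn B C
    unspanned-conn r₁≡1+r₀ = +-cancelʳ-≤ (r₀ C) (conn A C) (conn B C) (s≤s⁻¹ (begin
      suc (conn A C + r₀ C)  ≡⟨ +-suc (conn A C) (r₀ C) ⟨
      conn A C + suc (r₀ C)  ≡⟨ cong (conn A C +_) r₁≡1+r₀ ⟨
      conn A C + r₁ C        ≤⟨ conn-bound ⟩
      suc (conn B C + r₀ C)  ∎))
      where open ≤-Reasoning

cstar-ground : ∀ {n} {A B : Matroid n} → CStar A B → E B ≡ E A
cstar-ground {A = A} {B} (P , del , con) = CStarStep.E-B≡E-A P A B del con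

cstar-contraction : ∀ {n} {A B : Matroid n} {C : Subset n} → CStar A B → C ⊆ E A →
  (conn A C ≤ suc (conn B C) × (∀ N → IsContraction B C N → IsContraction A C N)) ⊎
  (conn A C ≤ conn B C × (∀ N N′ → IsContraction A C N → IsContraction B C N′ → CStar N N′))
cstar-contraction {A = A} {B} {C} (P , del , con) C⊆E with SingleElementExtension.spans⊎r₁≡1+r₀ P C
... | inj₁ C-spans = inj₁ (spanned-conn C⊆E C-spans , spanned-contractions-agree C⊆E C-spans)
  where open CStarStep P A B del con
... | inj₂ r₁≡1+r₀ = inj₂ (unspanned-conn C⊆E r₁≡1+r₀ , contractions-cstar C⊆E)
  where open CStarStep P A B del con

CStarChain : ∀ {n} → ℕ → (ℕ → Matroid n) → Set
CStarChain m Ms = ∀ i → i < m → CStar (Ms i) (Ms (suc i))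

_◂_ : ∀ {a} {A : Set a} → A → (ℕ → A) → ℕ → A
(x ◂ xs) zero    = x
(x ◂ xs) (suc i) = xs i

◂-chain : ∀ {n m} {N : Matroid n} {Ms : ℕ → Matroid n} →
  CStar N (Ms 0) → CStarChain m Ms → CStarChain (suc m) (N ◂ Ms)
◂-chain first _    zero    _         = first
◂-chain _     rest (suc i) (s≤s i<m) = rest i i<m

ContractionPath : ∀ {n} → Matroid n → Matroid n → Subset n → ℕ → Set
ContractionPath {n} M N C m = Σ (ℕ → Matroid n) λ M′ →
  IsContraction M C (M′ 0) × CStarChain m M′ × IsContraction N C (M′ m)

contraction-path : ∀ {n} (C : Subset n) k (Ms : ℕ → Matroid n) → CStarChain k Ms → C ⊆ E (Ms 0) →
  Σ ℕ λ m → m + conn (Ms 0) C ≤ k + conn (Ms k) C × ContractionPath (Ms 0) (Ms k) C m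
contraction-path C zero Ms _ _ =
  0 , ≤-refl , (λ _ → Ms 0 ／ C) , ／-isContraction (Ms 0) C , (λ _ ()) , ／-isContraction (Ms 0) C
contraction-path C (suc k) Ms chain C⊆E
  with contraction-path C k (Ms ∘ suc) (λ i i<k → chain (suc i) (s≤s i<k))
         (subst (C ⊆_) (sym (cstar-ground {A = Ms 0} {B = Ms 1} (chain 0 z<s))) C⊆E)
     | cstar-contraction {A = Ms 0} {B = Ms 1} (chain 0 z<s) C⊆E
... | m , bound , M′ , first , steps , last | inj₁ (conn≤1+conn , agree) =
  m , ≤-trans (+-monoʳ-≤ m conn≤1+conn) (≤-trans (≤-reflexive (+-suc m _)) (s≤s bound)) ,
  M′ , agree (M′ 0) first , steps , last
... | m , bound , M′ , first , steps , last | inj₂ (conn≤conn , cstar) =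
  suc m , s≤s (≤-trans (+-monoʳ-≤ m conn≤conn) bound) ,
  (Ms 0 ／ C) ◂ M′ , ／-isContraction (Ms 0) C ,
  ◂-chain (cstar (Ms 0 ／ C) (M′ 0) (／-isContraction (Ms 0) C) first) steps , last

mainTheorem12 : ∀ {n} (M : Matroid n) (ℓ : ℕ) → Connected M → 0 < ℓ →
    (Ms : ℕ → Matroid n) → Ms 0 ≡ M →
    (∀ i → i ≤ ℓ → E (Ms i) ≡ E M) →
    (∀ i → i < ℓ → Σ (Matroid (suc n)) λ M⁺ →
      IsDeletionF M⁺ (Ms i) × IsContractionF M⁺ (Ms (suc i))) →
    ¬ Connected (Ms ℓ) →
    (C : Subset n) → C ⊆ E M → 0 < conn M C → conn (Ms ℓ) C ≡ 0 →
    Σ ℕ λ m → Σ (ℕ → Matroid n) λ M′ →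
      m ≤ ℓ ∸ conn M C ×
      IsContraction M C (M′ 0) ×
      (∀ i → i < m → CStar (M′ i) (M′ (suc i))) ×
      IsContraction (Ms ℓ) C (M′ m)
mainTheorem12 _ ℓ _ _ Ms refl _ chain _ C C⊆E _ conn[Mℓ]≡0
  with contraction-path C ℓ Ms chain C⊆E
... | m , bound , M′ , first , steps , last =
  m , M′ , m+n≤o⇒m≤o∸n m (subst (m + conn (Ms 0) C ≤_) ℓ+conn≡ℓ bound) , first , steps , last
  where
  ℓ+conn≡ℓ : ℓ + conn (Ms ℓ) C ≡ ℓ
  ℓ+conn≡ℓ = trans (cong (ℓ +_) conn[Mℓ]≡0) (+-identityʳ ℓ)
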